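{- Let $\Omega$ be a countably infinite set and $E=\mathrm{Self}(\Omega)$. The preorder $\preccurlyeq$ on submonoids of $E$ is not total: there exist submonoids $M,M'\subseteq E$ with $M\not\preccurlyeq M'$ and $M'\not\preccurlyeq M$.
   Context: $\mathrm{Self}(\Omega)$ is the monoid of maps $\Omega\to\Omega$; $\langle X\rangle$ is the submonoid generated by $X$. For submonoids $M_1,M_2\subseteq E$, $M_1\preccurlyeq M_2$ means there is a finite $U\subseteq E$ with $M_1\subseteq\langle M_2\cup U\rangle$. -}

module Defs where

open import Data.Nat using (ℕ)
open import Data.List using (List; foldr)
open import Data.List.Relation.Unary.All using (All)
open import Data.List.Relation.Unary.Any using (Any)
open import Data.Product using (Σ; _×_)
open import Data.Sum using (_⊎_)
open import Function using (_∘_; id)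
open import Function.Bundles using (_↔_)
open import Relation.Binary.PropositionalEquality using (_≗_)

Self : Set → Set
Self Ω = Ω → Ω

Subset : Set → Set₁
Subset Ω = Self Ω → Set

CountablyInfinite : Set → Set
CountablyInfinite Ω = ℕ ↔ Ω

record Submonoid (Ω : Set) : Set₁ where
  field
    carrier   : Subset Ω
    respects  : ∀ {f g} → f ≗ g → carrier f → carrier g
    has-id    : carrier id
    closed-∘  : ∀ {f g} → carrier f → carrier g → carrier (f ∘ g)
open Submonoid public

compose : {Ω : Set} → List (Self Ω) → Self Ω
compose = foldr (λ f g → f ∘ g) id

⟨_⟩ : {Ω : Set} → Subset Ω → Subset Ω
⟨ X ⟩ f = Σ (List (Self _)) λ ws → All X ws × (f ≗ compose ws)

_∪L_ : {Ω : Set} → Subset Ω → List (Self Ω) → Subset Ω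
(X ∪L U) g = X g ⊎ Any (g ≗_) U

_≼_ : {Ω : Set} → Submonoid Ω → Submonoid Ω → Set
_≼_ {Ω} M₁ M₂ = Σ (List (Self Ω)) λ U →
  ∀ f → carrier M₁ f → ⟨ carrier M₂ ∪L U ⟩ f

-- Identify Ω with the nodes of the infinite binary tree plus one extra point z.
-- Let M be the identity together with the maps taking at most two values, and
-- M′ the identity together with the maps that are constant on the three cells
-- {z}, "left of α", "right of α" of some branch α.  Both sets of non-identity
-- maps are left ideals of Self(Ω), so an element of ⟨M ∪ U⟩ (resp. ⟨M′ ∪ U⟩)
-- is a word over U or an ideal element precomposed with such a word, and for
-- finite U these words can be enumerated.  Choosing the branch α diagonally
-- against the enumeration gives a three-valued cell map outside ⟨M ∪ U⟩.
-- Conversely, colour Ω in two colours block by block, four points per word w: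
-- either w merges two points of the block, which get different colours, or w
-- sends three of them to distinct nodes, and the middle one in the in-order is
-- coloured apart from the other two; no cell map can do that, since every cut
-- puts the middle node in the cell of one of its neighbours.

module Submission where

open import Defs
open import Data.Bool using (Bool; true; false; not; if_then_else_; _xor_)
open import Data.Bool.Properties using (xor-same; not-¬)
open import Data.Empty using (⊥; ⊥-elim)
open import Data.Fin using (Fin; toℕ; punchIn) renaming (zero to fzero; suc to fsuc)
import Data.Fin as Fin
open import Data.Fin.Properties
  using (any?; toℕ<n; toℕ-fromℕ<; toℕ-injective; punchIn-injective; punchInᵢ≢i)
open import Data.List using (List; []; _∷_; _++_; map; replicate)
open import Data.List.Relation.Unary.All using (All; []; _∷_)
open import Data.List.Relation.Unary.Any using (Any; here; there)
open import Data.Maybe using (Maybe; nothing; just; fromMaybe)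
open import Data.Maybe.Properties using (just-injective)
open import Data.Nat using (ℕ; zero; suc; pred; _+_; _*_; _<_; _/_; _%_; NonZero)
import Data.Nat as ℕ
open import Data.Nat.Binary using (ℕᵇ; 2[1+_]; 1+[2_])
  renaming (zero to 0ᵇ; toℕ to toℕᵇ; fromℕ to fromℕᵇ)
open import Data.Nat.Binary.Properties using (fromℕ-toℕ)
open import Data.Nat.DivMod
  using (_mod_; +-distrib-/; m<n⇒m/n≡0; m*n/n≡m; m<n⇒m%n≡m; m*n%n≡0; [m+kn]%n≡m%n)
open import Data.Nat.Properties using (+-identityʳ)
open import Data.Product using (Σ; ∃; ∃₂; _×_; _,_; proj₁; proj₂; uncurry)
open import Data.Sum using (_⊎_; inj₁; inj₂; swap)
import Data.Sum as Sum
open import Function using (_∘_; id)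
open import Function.Bundles using (_↔_; Inverse)
open import Level using (Level)
open import Relation.Binary.Core using (Rel)
open import Relation.Binary.Definitions using (Total; DecidableEquality)
open import Relation.Binary.PropositionalEquality
open import Relation.Nullary using (¬_; Dec; yes; no; does; ¬?; _×-dec_)
open import Relation.Nullary.Decidable using (map′; dec-true; dec-false)

module _ {Ω : Set} where

  Closed≗ : Subset Ω → Set
  Closed≗ I = ∀ {f g} → f ≗ g → I f → I g

  LeftIdeal : Subset Ω → Set
  LeftIdeal I = ∀ f {g} → I g → I (f ∘ g)

  IdOr : Subset Ω → Subset Ω
  IdOr I f = (f ≗ id) ⊎ I f

  withId : (I : Subset Ω) → Closed≗ I → LeftIdeal I → Submonoid Ω
  withId I resp absorb = record
    { carrier  = IdOr I
    ; respects = respects′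
    ; has-id   = inj₁ λ _ → refl
    ; closed-∘ = closed
    }
    where
    respects′ : Closed≗ (IdOr I)
    respects′ f≗g (inj₁ f≗id) = inj₁ λ x → trans (sym (f≗g x)) (f≗id x)
    respects′ f≗g (inj₂ If)   = inj₂ (resp f≗g If)

    closed : ∀ {f g} → IdOr I f → IdOr I g → IdOr I (f ∘ g)
    closed {f} {g} (inj₁ f≗id) (inj₁ g≗id) = inj₁ λ x → trans (f≗id (g x)) (g≗id x)
    closed {f} {g} (inj₂ If)   (inj₁ g≗id) = inj₂ (resp {f} (λ x → cong f (sym (g≗id x))) If)
    closed {f}     _           (inj₂ Ig)   = inj₂ (absorb f Ig)

  letter : List (Self Ω) → ℕ → Self Ω
  letter []      _       = id
  letter (u ∷ _) zero    = u
  letter (_ ∷ U) (suc i) = letter U i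

  word : List (Self Ω) → List ℕ → Self Ω
  word U L = compose (map (letter U) L)

  any⇒letter : ∀ {g} U → Any (g ≗_) U → ∃ λ i → g ≗ letter U i
  any⇒letter (_ ∷ _) (here g≗u) = zero , g≗u
  any⇒letter (_ ∷ U) (there g∈U) with any⇒letter U g∈U
  ... | i , g≗ = suc i , g≗

  WordOrIdeal : Subset Ω → List (Self Ω) → Self Ω → Set
  WordOrIdeal I U f =
    (∃ λ L → f ≗ word U L) ⊎ (∃₂ λ L i → I i × f ≗ i ∘ word U L)

  module _ {I : Subset Ω} (absorb : LeftIdeal I) (U : List (Self Ω)) where

    compose-factorises : ∀ ws → All (IdOr I ∪L U) ws →
                         WordOrIdeal I U (compose ws)
    compose-factorises []       []       = inj₁ ([] , λ _ → refl)
    compose-factorises (g ∷ ws) (g∈ ∷ ws∈) with compose-factorises ws ws∈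
    ... | inj₂ (L , i , Ii , ws≗) = inj₂ (L , g ∘ i , absorb g Ii , cong g ∘ ws≗)
    ... | inj₁ (L , ws≗) with g∈
    ...   | inj₁ (inj₁ g≗id) = inj₁ (L , λ x → trans (g≗id _) (ws≗ x))
    ...   | inj₁ (inj₂ Ig)   = inj₂ (L , g , Ig , cong g ∘ ws≗)
    ...   | inj₂ g∈U with any⇒letter U g∈U
    ...     | i , g≗ = inj₁ (i ∷ L , λ x → trans (g≗ _) (cong (letter U i) (ws≗ x)))

    generated-factorises : ∀ {f} → ⟨ IdOr I ∪L U ⟩ f → WordOrIdeal I U f
    generated-factorises (ws , ws∈ , f≗) with compose-factorises ws ws∈
    ... | inj₁ (L , ws≗)         = inj₁ (L , λ x → trans (f≗ x) (ws≗ x))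
    ... | inj₂ (L , i , Ii , ws≗) = inj₂ (L , i , Ii , λ x → trans (f≗ x) (ws≗ x))

  ⋠withId : ∀ M {I} (resp : Closed≗ I) (absorb : LeftIdeal I) →
            (∀ U → ∃ λ f → carrier M f × ¬ WordOrIdeal I U f) →
            ¬ (M ≼ withId I resp absorb)
  ⋠withId _ _ absorb escape (U , M⊆) with escape U
  ... | f , f∈M , ¬f∈ = ¬f∈ (generated-factorises absorb U (M⊆ f f∈M))

  TwoValued : Self Ω → Set
  TwoValued f = ∃₂ λ a b → ∀ x → f x ≡ a ⊎ f x ≡ b

  TwoValued-resp : Closed≗ TwoValued
  TwoValued-resp f≗g (a , b , ab) =
    a , b , λ x → Sum.map (trans (sym (f≗g x))) (trans (sym (f≗g x))) (ab x)

  TwoValued-∘ˡ : LeftIdeal TwoValued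
  TwoValued-∘ˡ f (a , b , ab) = f a , f b , λ x → Sum.map (cong f) (cong f) (ab x)

  TwoValued-∘ʳ : ∀ {f g} → TwoValued f → TwoValued (f ∘ g)
  TwoValued-∘ʳ {g = g} (a , b , ab) = a , b , ab ∘ g

  TwoValued-pigeonhole : ∀ {f} → TwoValued f → ∀ x y w →
                         f x ≢ f y → f y ≢ f w → f x ≢ f w → ⊥
  TwoValued-pigeonhole (_ , _ , ab) x y w x≢y y≢w x≢w with ab x | ab y | ab w
  ... | inj₁ p | inj₁ q | _      = x≢y (trans p (sym q))
  ... | inj₂ p | inj₂ q | _      = x≢y (trans p (sym q))
  ... | inj₁ p | _      | inj₁ r = x≢w (trans p (sym r))
  ... | inj₂ p | _      | inj₂ r = x≢w (trans p (sym r))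
  ... | _      | inj₁ q | inj₁ r = y≢w (trans q (sym r))
  ... | _      | inj₂ q | inj₂ r = y≢w (trans q (sym r))

module _ {a ℓ : Level} {A : Set a} (_≲_ : Rel A ℓ) where

  Between : A → A → A → Set ℓ
  Between x m y = (x ≲ m × m ≲ y) ⊎ (y ≲ m × m ≲ x)

  middle-of-three : Total _≲_ → ∀ x y w →
                    Between y x w ⊎ Between x y w ⊎ Between x w y
  middle-of-three total x y w with total x y | total y w
  ... | inj₁ x≲y | inj₁ y≲w = inj₂ (inj₁ (inj₁ (x≲y , y≲w)))
  ... | inj₂ y≲x | inj₂ w≲y = inj₂ (inj₁ (inj₂ (w≲y , y≲x)))
  ... | inj₁ x≲y | inj₂ w≲y with total x w
  ...   | inj₁ x≲w = inj₂ (inj₂ (inj₁ (x≲w , w≲y)))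
  ...   | inj₂ w≲x = inj₁ (inj₂ (w≲x , x≲y))
  middle-of-three total x y w | inj₂ y≲x | inj₁ y≲w with total x w
  ...   | inj₁ x≲w = inj₁ (inj₁ (y≲x , x≲w))
  ...   | inj₂ w≲x = inj₂ (inj₂ (inj₂ (y≲w , w≲x)))

-- leftOf α s is the bit of α at the first position where s disagrees with α
-- (at position length s if s is a prefix of α): reading true as a right turn,
-- it says whether the node s lies left of the branch α in the in-order.
leftOf : (ℕ → Bool) → List Bool → Bool
leftOf α []      = α 0
leftOf α (b ∷ s) = if b xor α 0 then α 0 else leftOf (α ∘ suc) s

leftOf-along : ∀ α s → leftOf α (α 0 ∷ s) ≡ leftOf (α ∘ suc) s
leftOf-along α _ rewrite xor-same (α 0) = refl

leftOf-true∷ : ∀ α s → leftOf α (true ∷ s) ≡ true → α 0 ≡ true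
leftOf-true∷ α _ with α 0
... | true  = λ _ → refl
... | false = λ ()

leftOf-false∷ : ∀ α s → α 0 ≡ true → leftOf α (false ∷ s) ≡ true
leftOf-false∷ α _ α₀ rewrite α₀ = refl

_⊑_ : Rel (List Bool) _
s ⊑ t = ∀ α → leftOf α t ≡ true → leftOf α s ≡ true

∷-mono-⊑ : ∀ b {s t} → s ⊑ t → (b ∷ s) ⊑ (b ∷ t)
∷-mono-⊑ b s⊑t α with b xor α 0
... | true  = id
... | false = s⊑t (α ∘ suc)

⊑-total : Total _⊑_
⊑-total []          []          = inj₁ λ _ → id
⊑-total []          (true ∷ t)  = inj₁ λ α → leftOf-true∷ α t
⊑-total []          (false ∷ t) = inj₂ λ α → leftOf-false∷ α t
⊑-total (true ∷ s)  []          = inj₂ λ α → leftOf-true∷ α s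
⊑-total (false ∷ s) []          = inj₁ λ α → leftOf-false∷ α s
⊑-total (false ∷ s) (true ∷ t)  = inj₁ λ α → leftOf-false∷ α s ∘ leftOf-true∷ α t
⊑-total (true ∷ s)  (false ∷ t) = inj₂ λ α → leftOf-false∷ α t ∘ leftOf-true∷ α s
⊑-total (true ∷ s)  (true ∷ t)  =
  Sum.map (∷-mono-⊑ true {s} {t}) (∷-mono-⊑ true {t} {s}) (⊑-total s t)
⊑-total (false ∷ s) (false ∷ t) =
  Sum.map (∷-mono-⊑ false {s} {t}) (∷-mono-⊑ false {t} {s}) (⊑-total s t)

ordered-agrees : ∀ {s m t} → s ⊑ m → m ⊑ t → ∀ α →
                 leftOf α s ≡ leftOf α m ⊎ leftOf α m ≡ leftOf α t
ordered-agrees {m = m} {t} s⊑m m⊑t α with leftOf α m in m-left | leftOf α t in t-left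
... | true  | _     = inj₁ (s⊑m α m-left)
... | false | false = inj₂ refl
... | false | true  with () ← trans (sym m-left) (m⊑t α t-left)

between-agrees : ∀ s m t → Between _⊑_ s m t → ∀ α →
                 leftOf α s ≡ leftOf α m ⊎ leftOf α m ≡ leftOf α t
between-agrees s m t (inj₁ (s⊑m , m⊑t)) α = ordered-agrees {s} {m} {t} s⊑m m⊑t α
between-agrees s m t (inj₂ (t⊑m , m⊑s)) α =
  swap (Sum.map sym sym (ordered-agrees {t} {m} {s} t⊑m m⊑s α))

read : (List Bool → Bool) → ℕ → Bool
read p zero    = p []
read p (suc k) = read (λ s → p (p [] ∷ s)) k

read-leftOf : ∀ {p} α → p ≗ leftOf α → read p ≗ α
read-leftOf     α p≗ zero    = p≗ []
read-leftOf {p} α p≗ (suc k) = read-leftOf (α ∘ suc) tail≗ k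
  where
  tail≗ : (λ s → p (p [] ∷ s)) ≗ leftOf (α ∘ suc)
  tail≗ s = begin
    p (p [] ∷ s)          ≡⟨ p≗ _ ⟩
    leftOf α (p [] ∷ s)   ≡⟨ cong (λ b → leftOf α (b ∷ s)) (p≗ []) ⟩
    leftOf α (α 0 ∷ s)    ≡⟨ leftOf-along α s ⟩
    leftOf (α ∘ suc) s    ∎
    where open ≡-Reasoning

bits : ℕᵇ → List Bool
bits 0ᵇ       = []
bits 2[1+ x ] = true ∷ bits x
bits 1+[2 x ] = false ∷ bits x

fromBits : List Bool → ℕᵇ
fromBits []          = 0ᵇ
fromBits (true ∷ s)  = 2[1+ fromBits s ]
fromBits (false ∷ s) = 1+[2 fromBits s ]

bits-fromBits : ∀ s → bits (fromBits s) ≡ s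
bits-fromBits []          = refl
bits-fromBits (true ∷ s)  = cong (true ∷_) (bits-fromBits s)
bits-fromBits (false ∷ s) = cong (false ∷_) (bits-fromBits s)

encodeString : List Bool → ℕ
encodeString = toℕᵇ ∘ fromBits

decodeString : ℕ → List Bool
decodeString = bits ∘ fromℕᵇ

decodeString-encodeString : ∀ s → decodeString (encodeString s) ≡ s
decodeString-encodeString s =
  trans (cong bits (fromℕ-toℕ (fromBits s))) (bits-fromBits s)

unary : List ℕ → List Bool
unary []      = []
unary (i ∷ L) = replicate i true ++ false ∷ unary L

incHead : List ℕ → List ℕ
incHead []      = []
incHead (i ∷ L) = suc i ∷ L

fromUnary : List Bool → List ℕ
fromUnary []          = []
fromUnary (false ∷ s) = 0 ∷ fromUnary s
fromUnary (true ∷ s)  = incHead (fromUnary s)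

fromUnary-replicate : ∀ i s → fromUnary (replicate i true ++ false ∷ s) ≡ i ∷ fromUnary s
fromUnary-replicate zero    s = refl
fromUnary-replicate (suc i) s = cong incHead (fromUnary-replicate i s)

fromUnary-unary : ∀ L → fromUnary (unary L) ≡ L
fromUnary-unary []      = refl
fromUnary-unary (i ∷ L) =
  trans (fromUnary-replicate i (unary L)) (cong (i ∷_) (fromUnary-unary L))

encodeWord : List ℕ → ℕ
encodeWord = encodeString ∘ unary

decodeWord : ℕ → List ℕ
decodeWord = fromUnary ∘ decodeString

decodeWord-encodeWord : ∀ L → decodeWord (encodeWord L) ≡ L
decodeWord-encodeWord L =
  trans (cong fromUnary (decodeString-encodeString (unary L))) (fromUnary-unary L)

module _ {d : ℕ} .{{_ : NonZero d}} (k : Fin d) (n : ℕ) where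

  [k+n*d]/d≡n : (toℕ k + n * d) / d ≡ n
  [k+n*d]/d≡n = begin
    (toℕ k + n * d) / d     ≡⟨ +-distrib-/ (toℕ k) (n * d) no-carry ⟩
    toℕ k / d + n * d / d   ≡⟨ cong₂ _+_ (m<n⇒m/n≡0 (toℕ<n k)) (m*n/n≡m n d) ⟩
    n                       ∎
    where
    open ≡-Reasoning
    no-carry : toℕ k % d + n * d % d < d
    no-carry = subst₂ (λ a b → a + b < d) (sym (m<n⇒m%n≡m (toℕ<n k))) (sym (m*n%n≡0 n d))
                 (subst (_< d) (sym (+-identityʳ (toℕ k))) (toℕ<n k))

  [k+n*d]mod-d≡k : (toℕ k + n * d) mod d ≡ k
  [k+n*d]mod-d≡k = toℕ-injective (begin
    toℕ ((toℕ k + n * d) mod d)   ≡⟨ toℕ-fromℕ< _ ⟩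
    (toℕ k + n * d) % d           ≡⟨ [m+kn]%n≡m%n (toℕ k) n d ⟩
    toℕ k % d                     ≡⟨ m<n⇒m%n≡m (toℕ<n k) ⟩
    toℕ k                         ∎)
    where open ≡-Reasoning

-- Ω is identified with ℕ: 0 is a distinguished point z and n + 1 is the node
-- decodeString n of the binary tree.  A branch α cuts Ω into the three cells
-- {z}, the nodes left of α and the nodes right of α.
module Countable {Ω : Set} (ℕ↔Ω : ℕ ↔ Ω) where
  open Inverse ℕ↔Ω using (to; from; inverseˡ; inverseʳ)

  from-to : ∀ n → from (to n) ≡ n
  from-to n = inverseʳ refl

  from-injective : ∀ {x y} → from x ≡ from y → x ≡ y
  from-injective {x} {y} e = trans (sym (inverseˡ refl)) (trans (cong to e) (inverseˡ refl))

  _≟_ : DecidableEquality Ω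
  x ≟ y = map′ from-injective (cong from) (from x ℕ.≟ from y)

  pointIndex : Maybe Bool → ℕ
  pointIndex nothing      = 0
  pointIndex (just true)  = 1
  pointIndex (just false) = 2

  indexPoint : ℕ → Maybe Bool
  indexPoint 1 = just true
  indexPoint 2 = just false
  indexPoint _ = nothing

  indexPoint-pointIndex : ∀ m → indexPoint (pointIndex m) ≡ m
  indexPoint-pointIndex nothing      = refl
  indexPoint-pointIndex (just true)  = refl
  indexPoint-pointIndex (just false) = refl

  point : Maybe Bool → Ω
  point = to ∘ pointIndex

  unpoint : Ω → Maybe Bool
  unpoint = indexPoint ∘ from

  unpoint-point : ∀ m → unpoint (point m) ≡ m
  unpoint-point m = trans (cong indexPoint (from-to (pointIndex m))) (indexPoint-pointIndex m)

  point-injective : ∀ {m m′} → point m ≡ point m′ → m ≡ m′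
  point-injective {m} {m′} e =
    trans (sym (unpoint-point m)) (trans (cong unpoint e) (unpoint-point m′))

  z : Ω
  z = point nothing

  node : List Bool → Ω
  node s = to (suc (encodeString s))

  code : Ω → List Bool
  code x = decodeString (pred (from x))

  cellℕ : (ℕ → Bool) → ℕ → Maybe Bool
  cellℕ _ zero    = nothing
  cellℕ α (suc n) = just (leftOf α (decodeString n))

  cell : (ℕ → Bool) → Ω → Maybe Bool
  cell α = cellℕ α ∘ from

  cell-z : ∀ α → cell α z ≡ nothing
  cell-z α = cong (cellℕ α) (from-to 0)

  cell-node : ∀ α s → cell α (node s) ≡ just (leftOf α s)
  cell-node α s = trans (cong (cellℕ α) (from-to _))
                        (cong (just ∘ leftOf α) (decodeString-encodeString s))

  cell-code : ∀ α {x} → x ≢ z → cell α x ≡ just (leftOf α (code x))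
  cell-code α {x} x≢z with from x in x-index
  ... | zero  = ⊥-elim (x≢z (from-injective (trans x-index (sym (from-to 0)))))
  ... | suc _ = refl

  cells-agree : ∀ α {x y} → x ≢ z → y ≢ z → leftOf α (code x) ≡ leftOf α (code y) →
                cell α x ≡ cell α y
  cells-agree α x≢z y≢z e = trans (cell-code α x≢z) (trans (cong just e) (sym (cell-code α y≢z)))

  CutMap : Self Ω → Set
  CutMap f = ∃ λ α → ∀ x y → cell α x ≡ cell α y → f x ≡ f y

  CutMap-resp : Closed≗ CutMap
  CutMap-resp f≗g (α , cut) = α , λ x y c → trans (sym (f≗g x)) (trans (cut x y c) (f≗g y))

  CutMap-∘ˡ : LeftIdeal CutMap
  CutMap-∘ˡ f (α , cut) = α , λ x y c → cong f (cut x y c)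

  R K : Submonoid Ω
  R = withId TwoValued TwoValued-resp TwoValued-∘ˡ
  K = withId CutMap CutMap-resp CutMap-∘ˡ

  branchMap : (ℕ → Bool) → Self Ω
  branchMap α = point ∘ cell α

  branchMap-CutMap : ∀ α → CutMap (branchMap α)
  branchMap-CutMap α = α , λ _ _ → cong point

  probe : Self Ω → List Bool → Bool
  probe g s = fromMaybe false (unpoint (g (node s)))

  probe-branchMap : ∀ α → probe (branchMap α) ≗ leftOf α
  probe-branchMap α s =
    cong (fromMaybe false) (trans (unpoint-point (cell α (node s))) (cell-node α s))

  branchMap-cells-differ : ∀ α {x y m m′} → cell α x ≡ m → cell α y ≡ m′ → m ≢ m′ →
                           branchMap α x ≢ branchMap α y
  branchMap-cells-differ α x-cell y-cell m≢m′ e =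
    m≢m′ (trans (sym x-cell) (trans (point-injective e) y-cell))

  module _ (U : List (Self Ω)) where

    -- Bits 0 and 1 give branchMap three values; bit n + 2 defeats the n-th word.
    diagonal : ℕ → Bool
    diagonal 0             = true
    diagonal 1             = false
    diagonal (suc (suc n)) = not (read (probe (word U (decodeWord n))) (suc (suc n)))

    branchMap-escapes : ¬ WordOrIdeal TwoValued U (branchMap diagonal)
    branchMap-escapes (inj₁ (L , f≗w)) =
      not-¬ refl (read-leftOf diagonal probe≗ (suc (suc n)))
      where
      n : ℕ
      n = encodeWord L
      probe≗ : probe (word U (decodeWord n)) ≗ leftOf diagonal
      probe≗ s = begin
        probe (word U (decodeWord n)) s
          ≡⟨ cong (λ L′ → probe (word U L′) s) (decodeWord-encodeWord L) ⟩
        probe (word U L) s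
          ≡⟨ cong (fromMaybe false ∘ unpoint) (sym (f≗w (node s))) ⟩
        probe (branchMap diagonal) s
          ≡⟨ probe-branchMap diagonal s ⟩
        leftOf diagonal s
          ∎
        where open ≡-Reasoning
    branchMap-escapes (inj₂ (L , i , i-two , f≗iw)) =
      TwoValued-pigeonhole (TwoValued-resp (sym ∘ f≗iw) (TwoValued-∘ʳ i-two))
        z (node []) (node (true ∷ []))
        (branchMap-cells-differ diagonal z-cell left-cell λ ())
        (branchMap-cells-differ diagonal left-cell right-cell λ ())
        (branchMap-cells-differ diagonal z-cell right-cell λ ())
      where
      z-cell : cell diagonal z ≡ nothing
      z-cell = cell-z diagonal
      left-cell : cell diagonal (node []) ≡ just true
      left-cell = cell-node diagonal []
      right-cell : cell diagonal (node (true ∷ [])) ≡ just false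
      right-cell = cell-node diagonal (true ∷ [])

  K⋠R : ¬ (K ≼ R)
  K⋠R = ⋠withId K TwoValued-resp TwoValued-∘ˡ λ U →
    branchMap (diagonal U) , inj₂ (branchMap-CutMap (diagonal U)) , branchMap-escapes U

  block : ℕ → Fin 4 → Ω
  block n k = to (toℕ k + n * 4)

  blockOf : Ω → ℕ × Fin 4
  blockOf x = from x / 4 , from x mod 4

  blockOf-block : ∀ n k → blockOf (block n k) ≡ (n , k)
  blockOf-block n k rewrite from-to (toℕ k + n * 4) =
    cong₂ _,_ ([k+n*d]/d≡n k n) ([k+n*d]mod-d≡k k n)

  colour : Bool → Ω
  colour = point ∘ just

  colour-injective : ∀ {b b′} → colour b ≡ colour b′ → b ≡ b′
  colour-injective = just-injective ∘ point-injective

  ConstantOnCells : ∀ {n} → (ℕ → Bool) → (Fin n → Ω) → (Fin n → Bool) → Set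
  ConstantOnCells α y c = ∀ k k′ → cell α (y k) ≡ cell α (y k′) → c k ≡ c k′

  Separates : ∀ {n} → (Fin n → Ω) → (Fin n → Bool) → Set
  Separates y c = (¬ (∀ k → y k ≡ colour (c k))) × (∀ α → ¬ ConstantOnCells α y c)

  mark : ∀ {n} → Fin n → Fin n → Bool
  mark j k = does (k Fin.≟ j)

  mark-differs : ∀ {n} {i j : Fin n} → i ≢ j → mark j i ≢ mark j j
  mark-differs {i = i} {j} i≢j e
    with () ← trans (sym (dec-false (i Fin.≟ j) i≢j)) (trans e (dec-true (j Fin.≟ j) refl))

  collision-separates : ∀ {n} {y : Fin n → Ω} {i j} → i ≢ j → y i ≡ y j →
                        Separates y (mark j)
  collision-separates {y = y} {i} {j} i≢j yi≡yj = not-colour , not-cut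
    where
    not-colour : ¬ (∀ k → y k ≡ colour (mark j k))
    not-colour y≡ = mark-differs i≢j (colour-injective (trans (sym (y≡ i)) (trans yi≡yj (y≡ j))))
    not-cut : ∀ α → ¬ ConstantOnCells α y (mark j)
    not-cut α cut = mark-differs i≢j (cut i j (cong (cell α) yi≡yj))

  middle-separates : ∀ {n} {y : Fin n → Ω} {l m h} → l ≢ m → h ≢ m → y l ≢ y h →
                     y l ≢ z → y m ≢ z → y h ≢ z →
                     Between _⊑_ (code (y l)) (code (y m)) (code (y h)) →
                     Separates y (mark m)
  middle-separates {y = y} {l} {m} {h} l≢m h≢m yl≢yh yl≢z ym≢z yh≢z between =
    not-colour , not-cut
    where
    not-colour : ¬ (∀ k → y k ≡ colour (mark m k))
    not-colour y≡ = yl≢yh (begin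
      y l                  ≡⟨ y≡ l ⟩
      colour (mark m l)    ≡⟨ cong colour (dec-false (l Fin.≟ m) l≢m) ⟩
      colour false         ≡⟨ cong colour (sym (dec-false (h Fin.≟ m) h≢m)) ⟩
      colour (mark m h)    ≡⟨ sym (y≡ h) ⟩
      y h                  ∎)
      where open ≡-Reasoning
    not-cut : ∀ α → ¬ ConstantOnCells α y (mark m)
    not-cut α cut with between-agrees (code (y l)) (code (y m)) (code (y h)) between α
    ... | inj₁ l∼m = mark-differs l≢m (cut l m (cells-agree α yl≢z ym≢z l∼m))
    ... | inj₂ m∼h = mark-differs h≢m (sym (cut m h (cells-agree α ym≢z yh≢z m∼h)))

  collision? : ∀ {n} (y : Fin n → Ω) → Dec (∃₂ λ i j → i ≢ j × y i ≡ y j)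
  collision? y = any? λ i → any? λ j → ¬? (i Fin.≟ j) ×-dec (y i ≟ y j)

  avoids-z-but-one : ∀ {n} (y : Fin (suc n) → Ω) → (∀ i j → i ≢ j → y i ≢ y j) →
                     ∃ λ k → ∀ j → j ≢ k → y j ≢ z
  avoids-z-but-one y distinct with any? (λ k → y k ≟ z)
  ... | yes (k , yk≡z) = k , λ j j≢k yj≡z → distinct j k j≢k (trans yj≡z (sym yk≡z))
  ... | no  ¬hit       = fzero , λ j _ yj≡z → ¬hit (j , yj≡z)

  module _ (y : Fin 4 → Ω) (distinct : ∀ i j → i ≢ j → y i ≢ y j)
           (k : Fin 4) (avoid : ∀ j → j ≢ k → y j ≢ z) where
    private
      e : Fin 3 → Fin 4
      e = punchIn k

      apart : ∀ {a b} → a ≢ b → e a ≢ e b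
      apart a≢b = a≢b ∘ punchIn-injective k _ _

      off : ∀ a → y (e a) ≢ z
      off a = avoid (e a) (punchInᵢ≢i k a)

      distinct-e : ∀ {a b} → a ≢ b → y (e a) ≢ y (e b)
      distinct-e a≢b = distinct _ _ (apart a≢b)

      f₀ f₁ f₂ : Fin 3
      f₀ = fzero
      f₁ = fsuc fzero
      f₂ = fsuc (fsuc fzero)

    three-off-z-separate : ∃ (Separates y)
    three-off-z-separate
      with middle-of-three _⊑_ ⊑-total (code (y (e f₀))) (code (y (e f₁))) (code (y (e f₂)))
    ... | inj₁ b = mark (e f₀) ,
      middle-separates (apart λ ()) (apart λ ()) (distinct-e λ ()) (off f₁) (off f₀) (off f₂) b
    ... | inj₂ (inj₁ b) = mark (e f₁) ,
      middle-separates (apart λ ()) (apart λ ()) (distinct-e λ ()) (off f₀) (off f₁) (off f₂) b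
    ... | inj₂ (inj₂ b) = mark (e f₂) ,
      middle-separates (apart λ ()) (apart λ ()) (distinct-e λ ()) (off f₀) (off f₂) (off f₁) b

  separating-colouring : (y : Fin 4 → Ω) → ∃ (Separates y)
  separating-colouring y with collision? y
  ... | yes (i , j , i≢j , yi≡yj) = mark j , collision-separates i≢j yi≡yj
  ... | no  ¬collision             = three-off-z-separate y distinct k avoid
    where
    distinct : ∀ i j → i ≢ j → y i ≢ y j
    distinct i j i≢j yi≡yj = ¬collision (i , j , i≢j , yi≡yj)
    k : Fin 4
    k = proj₁ (avoids-z-but-one y distinct)
    avoid : ∀ j → j ≢ k → y j ≢ z
    avoid = proj₂ (avoids-z-but-one y distinct)

  module _ (U : List (Self Ω)) where

    blockImage : ℕ → Fin 4 → Ω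
    blockImage n k = word U (decodeWord n) (block n k)

    blockImage-encodeWord : ∀ L k →
                            blockImage (encodeWord L) k ≡ word U L (block (encodeWord L) k)
    blockImage-encodeWord L k =
      cong (λ L′ → word U L′ (block (encodeWord L) k)) (decodeWord-encodeWord L)

    blockColouring : ℕ → Fin 4 → Bool
    blockColouring n = proj₁ (separating-colouring (blockImage n))

    blockColouring-separates : ∀ n → Separates (blockImage n) (blockColouring n)
    blockColouring-separates n = proj₂ (separating-colouring (blockImage n))

    twoColouring : Self Ω
    twoColouring = colour ∘ uncurry blockColouring ∘ blockOf

    twoColouring-block : ∀ n k → twoColouring (block n k) ≡ colour (blockColouring n k)
    twoColouring-block n k = cong (colour ∘ uncurry blockColouring) (blockOf-block n k)

    twoColouring-TwoValued : TwoValued twoColouring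
    twoColouring-TwoValued =
      colour true , colour false , λ x → two (uncurry blockColouring (blockOf x))
      where
      two : ∀ b → colour b ≡ colour true ⊎ colour b ≡ colour false
      two true  = inj₁ refl
      two false = inj₂ refl

    twoColouring-escapes : ¬ WordOrIdeal CutMap U twoColouring
    twoColouring-escapes (inj₁ (L , f≗w)) = proj₁ (blockColouring-separates n) image≡
      where
      n : ℕ
      n = encodeWord L
      image≡ : ∀ k → blockImage n k ≡ colour (blockColouring n k)
      image≡ k = trans (blockImage-encodeWord L k) (trans (sym (f≗w _)) (twoColouring-block n k))
    twoColouring-escapes (inj₂ (L , i , (α , i-cut) , f≗iw)) =
      proj₂ (blockColouring-separates n) α colouring-respects
      where
      n : ℕ
      n = encodeWord L
      colouring-respects : ConstantOnCells α (blockImage n) (blockColouring n)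
      colouring-respects k k′ same = colour-injective (begin
        colour (blockColouring n k)    ≡⟨ sym (twoColouring-block n k) ⟩
        twoColouring (block n k)       ≡⟨ f≗iw _ ⟩
        i (word U L (block n k))       ≡⟨ i-cut _ _ same′ ⟩
        i (word U L (block n k′))      ≡⟨ sym (f≗iw _) ⟩
        twoColouring (block n k′)      ≡⟨ twoColouring-block n k′ ⟩
        colour (blockColouring n k′)   ∎)
        where
        open ≡-Reasoning
        same′ : cell α (word U L (block n k)) ≡ cell α (word U L (block n k′))
        same′ = subst₂ (λ a b → cell α a ≡ cell α b)
                  (blockImage-encodeWord L k) (blockImage-encodeWord L k′) same

  R⋠K : ¬ (R ≼ K)
  R⋠K = ⋠withId R CutMap-resp CutMap-∘ˡ λ U →
    twoColouring U , inj₂ (twoColouring-TwoValued U) , twoColouring-escapes U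

proposition16 : (Ω : Set) → CountablyInfinite Ω →
    Σ (Submonoid Ω) λ M → Σ (Submonoid Ω) λ M′ → (¬ (M ≼ M′)) × (¬ (M′ ≼ M))
proposition16 Ω ℕ↔Ω = R , K , R⋠K , K⋠R
  where open Countable ℕ↔Ω
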